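{- Let $k\ge 1$ and $n\ge 1$. If the $(n-1)$-tuple of nonnegative integers $(\delta_1,\dots,\delta_{n-1})$ is valid, then for every $\delta_n\in\{0,1,\dots,\lceil M/k\rceil\}$, where $M=\sum_{i=1}^{n-1}(k-\delta_i)$, the $n$-tuple $(\delta_1,\dots,\delta_{n-1},\delta_n)$ is also valid.
   Context: For an array $A$ of distinct numbers and $j\ge1$, let $d_j(\ell)$ be the number of positions $\ell'\in(\ell,j]$ with $A[\ell']>A[\ell]$, and let $S_k(j)$ be the array of length $j$ with $S_k(j,\ell)=\min(d_j(\ell),k)$. Its size is $|S_k(j)|=\sum_{\ell=1}^{j}(k-S_k(j,\ell))$. A tuple of nonnegative integers $(\delta_1,\dots,\delta_{m})$ is valid if there exists an array $A[1..m+1]$ of distinct integers such that $\delta_j=|S_k(j)|-|S_k(j+1)|+k$ for every $j=1,\dots,m$ (the structures being those of $A$). -}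

module Defs where

open import Data.Nat as ℕ using (ℕ; zero; suc; _∸_; _⊓_; _<ᵇ_; NonZero)
open import Data.Integer as ℤ using (ℤ; +_; -_; _/ℕ_)
open import Data.Bool using (if_then_else_)
open import Relation.Nullary using (does)
open import Data.Integer.Properties using () renaming (_<?_ to _<ℤ?_)
open import Data.List using (List; []; _∷_; take; length)
open import Data.List.Relation.Unary.Unique.Propositional using (Unique)
open import Data.Fin using (Fin; toℕ)
open import Data.Vec using (Vec; lookup)
import Data.Vec
open import Data.Vec.Functional as VF using ()
open import Data.Product using (Σ; _×_)
open import Relation.Binary.PropositionalEquality using (_≡_)

-- Integer arrays are lists  A = A[1] ∷ A[2] ∷ … ; the prefix  take j A  is A[1..j].

countGreater : ℤ → List ℤ → ℕ
countGreater x []       = 0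
countGreater x (y ∷ ys) = (if does (x <ℤ? y) then 1 else 0) ℕ.+ countGreater x ys

-- For a prefix P = A[1..j]:
--   |S_k(j)| = Σ_{ℓ=1}^{j} (k - min(d_j(ℓ), k)),
-- where d_j(ℓ) = #{ℓ' ∈ (ℓ, j] : A[ℓ'] > A[ℓ]} = countGreater A[ℓ] A[ℓ+1..j].
sizeS : ℕ → List ℤ → ℕ
sizeS k []       = 0
sizeS k (x ∷ xs) = (k ∸ (countGreater x xs ⊓ k)) ℕ.+ sizeS k xs

sizeSk : ℕ → List ℤ → ℕ → ℕ
sizeSk k A j = sizeS k (take j A)

-- A tuple (δ_1,…,δ_m) is valid (w.r.t. k) if there is an array A[1..m+1] of
-- distinct integers with δ_j = |S_k(j)| - |S_k(j+1)| + k for j = 1..m.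
-- (lookup δ i is δ_{toℕ i + 1}.)
Valid : (k m : ℕ) → Vec ℕ m → Set
Valid k m δ =
  Σ (List ℤ) λ A →
    (length A ≡ suc m) × Unique A ×
    ((i : Fin m) →
      let j = suc (toℕ i) in
      + lookup δ i ≡ (+ sizeSk k A j ℤ.- + sizeSk k A (suc j)) ℤ.+ + k)

sumDefect : (k m : ℕ) → Vec ℕ m → ℤ
sumDefect k m δ = Data.Vec.foldr (λ _ → ℤ) (λ d acc → (+ k ℤ.- + d) ℤ.+ acc) (+ 0) δ

-- ⌈M / k⌉ for integer M and positive k  (_/ℕ_ is floor division for positive divisor)
ceilDiv : ℤ → (k : ℕ) → .{{NonZero k}} → ℤ
ceilDiv M k = - ((- M) /ℕ k)

-- Call an entry of a prefix active when fewer than k later entries exceed it, i.e. when its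
-- slack k − min(d, k) is positive. Appending a new last entry y leaves every slack unchanged
-- except that each active entry below y loses one unit, while y contributes slack k; hence
-- |S_k(m+1)| − |S_k(m+2)| + k is the number of active entries below y. The sizes telescope to
-- |S_k(m+1)| = k + M, and every slack is at most k, so there are more than ⌈M/k⌉ ≥ δₙ active
-- entries. After doubling all entries (which preserves the order, hence all the sizes), a
-- suitable odd value y has exactly δₙ active entries below it and differs from every entry.

module Submission where

open import Defs
open import Data.Nat using (ℕ; suc; NonZero)
open import Data.Integer using (+_; _≤_)
open import Data.Vec using (Vec; _∷ʳ_; []; _∷_; lookup)

open import Data.Bool using (true; false; if_then_else_)
open import Data.Fin using (Fin; toℕ; fromℕ; inject₁) renaming (zero to fzero; suc to fsuc)
import Data.Fin.Properties as FinP
open import Data.Integer as ℤ using (ℤ; 0ℤ; -_; _/ℕ_)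
import Data.Integer.Properties as ℤP
open import Data.Integer.DivMod using (n<s[n/ℕd]*d)
open import Data.Integer.Tactic.RingSolver using (solve-∀)
open import Data.List using (List; []; _∷_; _++_; [_]; length; map; take)
import Data.List.Properties as ListP
import Data.List.Extrema ℤP.≤-totalOrder as Extrema
open import Data.List.Membership.Propositional using (_∉_)
open import Data.List.Membership.Propositional.Properties using (∈-map⁻)
open import Data.List.Relation.Unary.All as All using (All; []; _∷_)
open import Data.List.Relation.Unary.Any using (here)
open import Data.List.Relation.Unary.AllPairs using ([]; _∷_)
open import Data.List.Relation.Unary.Unique.Propositional using (Unique)
import Data.List.Relation.Unary.Unique.Propositional.Properties as UniqueP
open import Data.Nat as ℕ using (zero; _∸_; _⊓_; z≤n; s≤s)
import Data.Nat.Properties as ℕP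
open import Algebra.Properties.CommutativeSemigroup ℕP.+-commutativeSemigroup
  using (x∙yz≈y∙xz; interchange)
open import Data.Product using (∃; _×_; _,_; proj₁; proj₂)
open import Data.Sum using (inj₁)
open import Function.Bundles using (_⇔_; mk⇔; module Equivalence)
open import Function.Properties.Equivalence using () renaming (sym to ⇔-sym)
open import Function.Base using (_∘_)
open import Relation.Binary.PropositionalEquality hiding ([_])
open import Relation.Nullary using (does; yes; no; ofʸ; ofⁿ)
open import Relation.Nullary.Decidable using (dec-true; dec-false; does-⇔)

slack : ℕ → ℕ → ℕ
slack k c = k ∸ (c ⊓ k)

slack-saturated : ∀ {k c} → k ℕ.≤ c → slack k c ≡ 0
slack-saturated {k} k≤c = trans (cong (k ∸_) (ℕP.m≥n⇒m⊓n≡n k≤c)) (ℕP.n∸n≡0 k)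

slack-suc : ∀ {k c} → c ℕ.< k → slack k (suc c) ℕ.+ 1 ≡ slack k c
slack-suc {k} {c} c<k = begin
  k ∸ (suc c ⊓ k) ℕ.+ 1  ≡⟨ cong (λ t → k ∸ t ℕ.+ 1) (ℕP.m≤n⇒m⊓n≡m c<k) ⟩
  k ∸ suc c ℕ.+ 1        ≡⟨ ℕP.+-comm (k ∸ suc c) 1 ⟩
  1 ℕ.+ (k ∸ suc c)      ≡⟨ ℕP.+-∸-assoc 1 c<k ⟨
  k ∸ c                  ≡⟨ cong (k ∸_) (ℕP.m≤n⇒m⊓n≡m (ℕP.<⇒≤ c<k)) ⟨
  k ∸ (c ⊓ k)            ∎
  where open ≡-Reasoning

actives : ℕ → List ℤ → List ℤ
actives k []       = []
actives k (x ∷ xs) = if countGreater x xs ℕ.<ᵇ k then x ∷ actives k xs else actives k xs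

countLess : ℤ → List ℤ → ℕ
countLess y []       = 0
countLess y (x ∷ xs) = (if does (x ℤP.<? y) then 1 else 0) ℕ.+ countLess y xs

countGreater-snoc : ∀ x xs y →
  countGreater x (xs ++ [ y ]) ≡ (if does (x ℤP.<? y) then 1 else 0) ℕ.+ countGreater x xs
countGreater-snoc x []       y = refl
countGreater-snoc x (z ∷ xs) y =
  trans (cong (bit z ℕ.+_) (countGreater-snoc x xs y)) (x∙yz≈y∙xz (bit z) (bit y) (countGreater x xs))
  where
  bit : ℤ → ℕ
  bit w = if does (x ℤP.<? w) then 1 else 0

regroup : ∀ {s′ b s S′ C S k} → s′ ℕ.+ b ≡ s → S′ ℕ.+ C ≡ S ℕ.+ k →
  (s′ ℕ.+ S′) ℕ.+ (b ℕ.+ C) ≡ (s ℕ.+ S) ℕ.+ k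
regroup {s′} {b} {s} {S′} {C} {S} {k} p q = begin
  (s′ ℕ.+ S′) ℕ.+ (b ℕ.+ C)  ≡⟨ interchange s′ S′ b C ⟩
  (s′ ℕ.+ b) ℕ.+ (S′ ℕ.+ C)  ≡⟨ cong₂ ℕ._+_ p q ⟩
  s ℕ.+ (S ℕ.+ k)            ≡⟨ ℕP.+-assoc s S k ⟨
  (s ℕ.+ S) ℕ.+ k            ∎
  where open ≡-Reasoning

sizeS-snoc : ∀ k P y → sizeS k (P ++ [ y ]) ℕ.+ countLess y (actives k P) ≡ sizeS k P ℕ.+ k
sizeS-snoc k []       y = trans (ℕP.+-identityʳ _) (ℕP.+-identityʳ k)
sizeS-snoc k (x ∷ xs) y rewrite countGreater-snoc x xs y
  with countGreater x xs ℕ.<ᵇ k | ℕP.<ᵇ-reflects-< (countGreater x xs) k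
... | true  | ofʸ active with x ℤP.<? y
...   | yes _ = regroup {b = 1} {k = k} (slack-suc active) (sizeS-snoc k xs y)
...   | no _  = regroup {b = 0} {k = k} (ℕP.+-identityʳ _) (sizeS-snoc k xs y)
sizeS-snoc k (x ∷ xs) y | false | ofⁿ inactive with x ℤP.<? y
...   | no _  = regroup {b = 0} {k = k} (ℕP.+-identityʳ _) (sizeS-snoc k xs y)
...   | yes _ = regroup {b = 0} {k = k} lost-nothing (sizeS-snoc k xs y)
  where
  saturated : k ℕ.≤ countGreater x xs
  saturated = ℕP.≮⇒≥ inactive
  lost-nothing : slack k (suc (countGreater x xs)) ℕ.+ 0 ≡ slack k (countGreater x xs)
  lost-nothing = trans (ℕP.+-identityʳ _)
    (trans (slack-saturated (ℕP.m≤n⇒m≤1+n saturated)) (sym (slack-saturated saturated)))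

sizeS≤length-actives*k : ∀ k P → sizeS k P ℕ.≤ length (actives k P) ℕ.* k
sizeS≤length-actives*k k []       = z≤n
sizeS≤length-actives*k k (x ∷ xs)
  with countGreater x xs ℕ.<ᵇ k | ℕP.<ᵇ-reflects-< (countGreater x xs) k
... | true  | ofʸ _ = ℕP.+-mono-≤ (ℕP.m∸n≤m k (countGreater x xs ⊓ k)) (sizeS≤length-actives*k k xs)
... | false | ofⁿ inactive rewrite slack-saturated (ℕP.≮⇒≥ inactive) = sizeS≤length-actives*k k xs

All-actives⁺ : ∀ {P : ℤ → Set} k {xs} → All P xs → All P (actives k xs)
All-actives⁺ k []                  = []
All-actives⁺ k {x ∷ xs} (px ∷ pxs) with countGreater x xs ℕ.<ᵇ k
... | true  = px ∷ All-actives⁺ k pxs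
... | false = All-actives⁺ k pxs

actives-unique : ∀ k {xs} → Unique xs → Unique (actives k xs)
actives-unique k []                    = []
actives-unique k {x ∷ xs} (x∉xs ∷ uniq) with countGreater x xs ℕ.<ᵇ k
... | true  = All-actives⁺ k x∉xs ∷ actives-unique k uniq
... | false = actives-unique k uniq

<suc⇔< : ∀ {x c} → c ≢ x → x ℤ.< ℤ.suc c ⇔ x ℤ.< c
<suc⇔< {x} {c} c≢x = mk⇔ (λ x<c+1 → ℤP.≤∧≢⇒< (x≤c x<c+1) (c≢x ∘ sym)) (λ x<c → ℤP.<-≤-trans x<c (ℤP.i≤suc[i] c))
  where
  x≤c : x ℤ.< ℤ.suc c → x ℤ.≤ c
  x≤c x<c+1 = ℤP.≮⇒≥ (λ c<x → ℤP.<-irrefl refl (ℤP.<-≤-trans x<c+1 (ℤP.i<j⇒suc[i]≤j c<x)))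

countLess-suc-∉ : ∀ {c xs} → All (c ≢_) xs → countLess (ℤ.suc c) xs ≡ countLess c xs
countLess-suc-∉ []                     = refl
countLess-suc-∉ {c} {x ∷ xs} (c≢x ∷ ps) =
  cong₂ (λ b r → (if b then 1 else 0) ℕ.+ r)
    (does-⇔ (<suc⇔< c≢x) (x ℤP.<? ℤ.suc c) (x ℤP.<? c)) (countLess-suc-∉ ps)

countLess-suc≤ : ∀ c {xs} → Unique xs → countLess (ℤ.suc c) xs ℕ.≤ suc (countLess c xs)
countLess-suc≤ c []                         = z≤n
countLess-suc≤ c {x ∷ xs} (x∉xs ∷ uniq) with x ℤ.≟ c
... | yes refl
  rewrite dec-true (x ℤP.<? ℤ.suc x) (ℤP.suc[i]≤j⇒i<j ℤP.≤-refl)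
        | dec-false (x ℤP.<? x) ℤP.i≮i
        | countLess-suc-∉ x∉xs = ℕP.≤-refl
... | no x≢c
  rewrite does-⇔ (<suc⇔< (x≢c ∘ sym)) (x ℤP.<? ℤ.suc c) (x ℤP.<? c) =
  ℕP.≤-trans (ℕP.+-monoʳ-≤ _ (countLess-suc≤ c uniq)) (ℕP.≤-reflexive (ℕP.+-suc _ _))

countLess-below : ∀ {c xs} → All (c ℤ.≤_) xs → countLess c xs ≡ 0
countLess-below []                         = refl
countLess-below {c} {x ∷ xs} (c≤x ∷ ps) rewrite dec-false (x ℤP.<? c) (ℤP.≤⇒≯ c≤x) =
  countLess-below ps

countLess-above : ∀ {c xs} → All (ℤ._< c) xs → countLess c xs ≡ length xs
countLess-above []                         = refl
countLess-above {c} {x ∷ xs} (x<c ∷ ps) rewrite dec-true (x ℤP.<? c) x<c =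
  cong suc (countLess-above ps)

discrete-ivt : (h : ℕ → ℕ) → (∀ n → h (suc n) ℕ.≤ suc (h n)) →
  ∀ N {r} → h 0 ℕ.≤ r → r ℕ.≤ h N → ∃ λ n → h n ≡ r
discrete-ivt h step zero    h0≤r r≤h0 = 0 , ℕP.≤-antisym h0≤r r≤h0
discrete-ivt h step (suc N) {r} h0≤r r≤h with r ℕ.≤? h N
... | yes r≤hN = discrete-ivt h step N h0≤r r≤hN
... | no  r≰hN = suc N , ℕP.≤-antisym (ℕP.≤-trans (step N) (ℕP.≰⇒> r≰hN)) r≤h

countLess-surjective : ∀ {L} → Unique L → ∀ {r} → r ℕ.≤ length L → ∃ λ c → countLess c L ≡ r
countLess-surjective {L} uniq {r} r≤|L| =
  let n , hn≡r = discrete-ivt h step N h0≤r r≤hN in lo ℤ.+ + n , hn≡r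
  where
  lo hi : ℤ
  lo = Extrema.min 0ℤ L
  hi = Extrema.max 0ℤ L
  h : ℕ → ℕ
  h n = countLess (lo ℤ.+ + n) L
  +-suc : ∀ a b → + 1 ℤ.+ (a ℤ.+ b) ≡ a ℤ.+ (+ 1 ℤ.+ b)
  +-suc = solve-∀
  +-cancel : ∀ a b → a ℤ.+ (b ℤ.- a) ≡ b
  +-cancel = solve-∀
  step : ∀ n → h (suc n) ℕ.≤ suc (h n)
  step n = subst (λ t → countLess t L ℕ.≤ suc (h n)) (+-suc lo (+ n)) (countLess-suc≤ (lo ℤ.+ + n) uniq)
  h0≤r : h 0 ℕ.≤ r
  h0≤r rewrite ℤP.+-identityʳ lo | countLess-below (Extrema.min≤xs 0ℤ L) = z≤n
  lo≤hi+1 : lo ℤ.≤ ℤ.suc hi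
  lo≤hi+1 = ℤP.≤-trans (Extrema.min≤⊤ 0ℤ L)
              (ℤP.≤-trans (Extrema.v≤max⁺ 0ℤ L (inj₁ ℤP.≤-refl)) (ℤP.i≤suc[i] hi))
  N : ℕ
  N = ℤ.∣ ℤ.suc hi ℤ.- lo ∣
  lo+N≡hi+1 : lo ℤ.+ + N ≡ ℤ.suc hi
  lo+N≡hi+1 = trans (cong (λ t → lo ℤ.+ t) (ℤP.0≤i⇒+∣i∣≡i (ℤP.i≤j⇒0≤j-i lo≤hi+1))) (+-cancel lo (ℤ.suc hi))
  r≤hN : r ℕ.≤ h N
  r≤hN rewrite lo+N≡hi+1
             | countLess-above (All.map (λ x≤hi → ℤP.≤-<-trans x≤hi (ℤP.suc[i]≤j⇒i<j ℤP.≤-refl))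
                                        (Extrema.xs≤max 0ℤ L)) = r≤|L|

countLess-map : ∀ {f : ℤ → ℤ} {c y} → (∀ x → x ℤ.< c ⇔ f x ℤ.< y) →
  ∀ L → countLess y (map f L) ≡ countLess c L
countLess-map below⇔ []       = refl
countLess-map {f} {c} {y} below⇔ (x ∷ xs) =
  cong₂ (λ b r → (if b then 1 else 0) ℕ.+ r)
    (does-⇔ (⇔-sym (below⇔ x)) (f x ℤP.<? y) (x ℤP.<? c)) (countLess-map below⇔ xs)

Realises : (k m : ℕ) → Vec ℕ m → List ℤ → Set
Realises k m δ A = (i : Fin m) → let j = suc (toℕ i) in
  + lookup δ i ≡ (+ sizeSk k A j ℤ.- + sizeSk k A (suc j)) ℤ.+ + k

Witness : (k m : ℕ) → Vec ℕ m → List ℤ → Set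
Witness k m δ A = length A ≡ suc m × Unique A × Realises k m δ A

module OrderEmbedding (f : ℤ → ℤ) (<⇔f< : ∀ {x y} → x ℤ.< y ⇔ f x ℤ.< f y) where

  f-injective : ∀ {x y} → f x ≡ f y → x ≡ y
  f-injective fx≡fy = ℤP.≤-antisym
    (ℤP.≮⇒≥ (λ y<x → ℤP.<-irrefl (sym fx≡fy) (Equivalence.to <⇔f< y<x)))
    (ℤP.≮⇒≥ (λ x<y → ℤP.<-irrefl fx≡fy (Equivalence.to <⇔f< x<y)))

  countGreater-map : ∀ x ys → countGreater (f x) (map f ys) ≡ countGreater x ys
  countGreater-map x []       = refl
  countGreater-map x (y ∷ ys) =
    cong₂ (λ b r → (if b then 1 else 0) ℕ.+ r)
      (does-⇔ (⇔-sym <⇔f<) (f x ℤP.<? f y) (x ℤP.<? y)) (countGreater-map x ys)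

  sizeS-map : ∀ k P → sizeS k (map f P) ≡ sizeS k P
  sizeS-map k []       = refl
  sizeS-map k (x ∷ xs) = cong₂ (λ c s → slack k c ℕ.+ s) (countGreater-map x xs) (sizeS-map k xs)

  actives-map : ∀ k P → actives k (map f P) ≡ map f (actives k P)
  actives-map k []       = refl
  actives-map k (x ∷ xs) rewrite countGreater-map x xs with countGreater x xs ℕ.<ᵇ k
  ... | true  = cong (f x ∷_) (actives-map k xs)
  ... | false = actives-map k xs

  witness-map : ∀ {k m δ A} → Witness k m δ A → Witness k m δ (map f A)
  witness-map {k} {m} {δ} {A} (len , uniq , realises) =
    trans (ListP.length-map f A) len , UniqueP.map⁺ f-injective uniq , realises′
    where
    sizeSk-map : ∀ j → sizeSk k (map f A) j ≡ sizeSk k A j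
    sizeSk-map j = trans (cong (sizeS k) (ListP.take-map j A)) (sizeS-map k (take j A))
    realises′ : Realises k m δ (map f A)
    realises′ i rewrite sizeSk-map (suc (toℕ i)) | sizeSk-map (suc (suc (toℕ i))) = realises i

telescope : ∀ k {m} (δ : Vec ℕ m) (f : ℕ → ℤ) →
  ((i : Fin m) → + lookup δ i ≡ (f (suc (toℕ i)) ℤ.- f (suc (suc (toℕ i)))) ℤ.+ + k) →
  f (suc m) ≡ f 1 ℤ.+ sumDefect k m δ
telescope k []          f drops = sym (ℤP.+-identityʳ (f 1))
telescope k {suc m} (d ∷ δ) f drops = begin
  f (suc (suc m))                                   ≡⟨ telescope k δ (f ∘ suc) (drops ∘ fsuc) ⟩
  f 2 ℤ.+ sumDefect k m δ                           ≡⟨ cong (ℤ._+ sumDefect k m δ) f2≡f1+k-d ⟩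
  (f 1 ℤ.+ (+ k ℤ.- + d)) ℤ.+ sumDefect k m δ       ≡⟨ ℤP.+-assoc (f 1) _ _ ⟩
  f 1 ℤ.+ ((+ k ℤ.- + d) ℤ.+ sumDefect k m δ)       ∎
  where
  open ≡-Reasoning
  solve-drop : ∀ a b c → b ≡ a ℤ.+ (c ℤ.- ((a ℤ.- b) ℤ.+ c))
  solve-drop = solve-∀
  f2≡f1+k-d : f 2 ≡ f 1 ℤ.+ (+ k ℤ.- + d)
  f2≡f1+k-d = trans (solve-drop (f 1) (f 2) (+ k)) (cong (λ t → f 1 ℤ.+ (+ k ℤ.- t)) (sym (drops fzero)))

sizeSk-all : ∀ k {A : List ℤ} {j} → length A ℕ.≤ j → sizeSk k A j ≡ sizeS k A
sizeSk-all k {A} {j} |A|≤j = cong (sizeS k) (ListP.take-all j A |A|≤j)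

sizeSk-one : ∀ k {A : List ℤ} {n} → length A ≡ suc n → sizeSk k A 1 ≡ k
sizeSk-one k {x ∷ _} _ = ℕP.+-identityʳ k

sizeS≡k+sumDefect : ∀ {k m δ A} → Witness k m δ A → + sizeS k A ≡ + k ℤ.+ sumDefect k m δ
sizeS≡k+sumDefect {k} {m} {δ} {A} (len , _ , realises) = begin
  + sizeS k A                          ≡⟨ cong +_ (sizeSk-all k {A} (ℕP.≤-reflexive len)) ⟨
  + sizeSk k A (suc m)                 ≡⟨ telescope k δ (λ j → + sizeSk k A j) realises ⟩
  + sizeSk k A 1 ℤ.+ sumDefect k m δ   ≡⟨ cong (λ s → + s ℤ.+ sumDefect k m δ) (sizeSk-one k {A} len) ⟩
  + k ℤ.+ sumDefect k m δ              ∎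
  where open ≡-Reasoning

take-++ˡ : ∀ {A : Set} n (xs ys : List A) → n ℕ.≤ length xs → take n (xs ++ ys) ≡ take n xs
take-++ˡ zero    xs       ys _         = refl
take-++ˡ (suc n) (x ∷ xs) ys (s≤s n≤) = cong (x ∷_) (take-++ˡ n xs ys n≤)

data Inject₁OrLast : ∀ {m} → Fin (suc m) → Set where
  inject : ∀ {m} (i : Fin m) → Inject₁OrLast (inject₁ i)
  last   : ∀ {m} → Inject₁OrLast (fromℕ m)

inject₁-or-last : ∀ {m} (i : Fin (suc m)) → Inject₁OrLast i
inject₁-or-last {zero}  fzero    = last
inject₁-or-last {suc m} fzero    = inject fzero
inject₁-or-last {suc m} (fsuc i) with inject₁-or-last i
... | inject j = inject (fsuc j)
... | last     = last

lookup-∷ʳ-inject₁ : ∀ {m} (δ : Vec ℕ m) x i → lookup (δ ∷ʳ x) (inject₁ i) ≡ lookup δ i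
lookup-∷ʳ-inject₁ (d ∷ δ) x fzero    = refl
lookup-∷ʳ-inject₁ (d ∷ δ) x (fsuc i) = lookup-∷ʳ-inject₁ δ x i

lookup-∷ʳ-last : ∀ {m} (δ : Vec ℕ m) x → lookup (δ ∷ʳ x) (fromℕ m) ≡ x
lookup-∷ʳ-last []      x = refl
lookup-∷ʳ-last (d ∷ δ) x = lookup-∷ʳ-last δ x

-- The hypothesis is additive so that no truncated subtraction occurs in ℕ.
drop-from-sum : ∀ {s s′ d k} → s′ ℕ.+ d ≡ s ℕ.+ k → + d ≡ (+ s ℤ.- + s′) ℤ.+ + k
drop-from-sum {s} {s′} {d} {k} eq = begin
  + d                          ≡⟨ solve-cancel (+ s′) (+ d) ⟨
  (+ s′ ℤ.+ + d) ℤ.- + s′      ≡⟨ cong (ℤ._- + s′) (cong +_ eq) ⟩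
  (+ s ℤ.+ + k) ℤ.- + s′       ≡⟨ solve-swap (+ s) (+ s′) (+ k) ⟩
  (+ s ℤ.- + s′) ℤ.+ + k       ∎
  where
  open ≡-Reasoning
  solve-cancel : ∀ a b → (a ℤ.+ b) ℤ.- a ≡ b
  solve-cancel = solve-∀
  solve-swap : ∀ a b c → (a ℤ.+ c) ℤ.- b ≡ (a ℤ.- b) ℤ.+ c
  solve-swap = solve-∀

witness-snoc : ∀ {k m δ A y δₙ} → Witness k m δ A → y ∉ A → countLess y (actives k A) ≡ δₙ →
  Witness k (suc m) (δ ∷ʳ δₙ) (A ++ [ y ])
witness-snoc {k} {m} {δ} {A} {y} {δₙ} (len , uniq , realises) y∉A below≡δₙ =
  len′ , UniqueP.++⁺ uniq ([] ∷ []) (λ { (y∈A , here refl) → y∉A y∈A }) , realises′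
  where
  A′ = A ++ [ y ]
  len′ : length A′ ≡ suc (suc m)
  len′ = trans (ListP.length-++ A) (trans (cong (ℕ._+ 1) len) (ℕP.+-comm (suc m) 1))
  prefix : ∀ j → j ℕ.≤ suc m → sizeSk k A′ j ≡ sizeSk k A j
  prefix j j≤ = cong (sizeS k) (take-++ˡ j A [ y ] (subst (j ℕ.≤_) (sym len) j≤))
  last-drop : sizeS k A′ ℕ.+ δₙ ≡ sizeS k A ℕ.+ k
  last-drop = subst (λ t → sizeS k A′ ℕ.+ t ≡ sizeS k A ℕ.+ k) below≡δₙ (sizeS-snoc k A y)
  realises′ : Realises k (suc m) (δ ∷ʳ δₙ) A′
  realises′ i with inject₁-or-last i
  ... | inject i′
    rewrite lookup-∷ʳ-inject₁ δ δₙ i′ | FinP.toℕ-inject₁ i′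
          | prefix (suc (toℕ i′)) (ℕP.<⇒≤ (s≤s (FinP.toℕ<n i′)))
          | prefix (suc (suc (toℕ i′))) (s≤s (FinP.toℕ<n i′)) = realises i′
  ... | last
    rewrite lookup-∷ʳ-last δ δₙ | FinP.toℕ-fromℕ m
          | prefix (suc m) ℕP.≤-refl | sizeSk-all k {A} (ℕP.≤-reflexive len)
          | sizeSk-all k {A′} (ℕP.≤-reflexive len′) = drop-from-sum last-drop

dbl : ℤ → ℤ
dbl x = x ℤ.+ x

dbl-mono-≤ : ∀ {x y} → x ℤ.≤ y → dbl x ℤ.≤ dbl y
dbl-mono-≤ x≤y = ℤP.+-mono-≤ x≤y x≤y

<⇔dbl< : ∀ {x y} → x ℤ.< y ⇔ dbl x ℤ.< dbl y
<⇔dbl< = mk⇔ (λ x<y → ℤP.+-mono-< x<y x<y) (λ 2x<2y → ℤP.≰⇒> (λ y≤x → ℤP.<⇒≱ 2x<2y (dbl-mono-≤ y≤x)))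

<⇔dbl<pred-dbl : ∀ {x c} → x ℤ.< c ⇔ dbl x ℤ.< ℤ.pred (dbl c)
<⇔dbl<pred-dbl {x} {c} = mk⇔ to from
  where
  dbl-suc : ∀ z → + 1 ℤ.+ (+ 1 ℤ.+ (z ℤ.+ z)) ≡ (+ 1 ℤ.+ z) ℤ.+ (+ 1 ℤ.+ z)
  dbl-suc = solve-∀
  to : x ℤ.< c → dbl x ℤ.< ℤ.pred (dbl c)
  to x<c = ℤP.suc[i]≤j⇒i<j (ℤP.i<j⇒i≤pred[j] (ℤP.<-≤-trans
    (ℤP.suc[i]≤j⇒i<j (ℤP.≤-reflexive (dbl-suc x))) (dbl-mono-≤ (ℤP.i<j⇒suc[i]≤j x<c))))
  from : dbl x ℤ.< ℤ.pred (dbl c) → x ℤ.< c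
  from 2x<2c-1 = ℤP.≰⇒> (λ c≤x → ℤP.<⇒≱ 2x<2c-1 (ℤP.i≤j⇒pred[i]≤j (dbl-mono-≤ c≤x)))

dbl≢pred-dbl : ∀ x c → dbl x ≢ ℤ.pred (dbl c)
dbl≢pred-dbl x c with x ℤP.<? c
... | yes x<c = ℤP.<⇒≢ (Equivalence.to <⇔dbl<pred-dbl x<c)
... | no  x≮c = λ eq → ℤP.<⇒≢ 2c-1<2x (sym eq)
  where
  2c-1<2x : ℤ.pred (dbl c) ℤ.< dbl x
  2c-1<2x = ℤP.<-≤-trans (ℤP.i≤pred[j]⇒i<j ℤP.≤-refl) (dbl-mono-≤ (ℤP.≮⇒≥ x≮c))

ceilDiv*k<k+M : ∀ M k .{{_ : NonZero k}} → ceilDiv M k ℤ.* + k ℤ.< + k ℤ.+ M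
ceilDiv*k<k+M M k = begin-strict
  - q ℤ.* + k                        ≡⟨ solve-shift q (+ k) ⟩
  + k ℤ.+ - ((+ 1 ℤ.+ q) ℤ.* + k)    <⟨ ℤP.+-monoʳ-< (+ k) (ℤP.neg-mono-< (n<s[n/ℕd]*d (- M) k)) ⟩
  + k ℤ.+ - - M                      ≡⟨ cong (λ t → + k ℤ.+ t) (ℤP.neg-involutive M) ⟩
  + k ℤ.+ M                          ∎
  where
  open ℤP.≤-Reasoning
  q : ℤ
  q = (- M) /ℕ k
  solve-shift : ∀ a b → - a ℤ.* b ≡ b ℤ.+ - ((+ 1 ℤ.+ a) ℤ.* b)
  solve-shift = solve-∀

≤ceilDiv⇒< : ∀ {M k n a} .{{_ : NonZero k}} → + n ≤ ceilDiv M k → + k ℤ.+ M ℤ.≤ + (a ℕ.* k) → n ℕ.< a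
≤ceilDiv⇒< {M} {k} {n} {a} n≤⌈M/k⌉ k+M≤ak = ℤP.drop‿+<+ (ℤP.*-cancelʳ-<-nonNeg (+ k) (begin-strict
  + n ℤ.* + k          ≤⟨ ℤP.*-monoʳ-≤-nonNeg (+ k) n≤⌈M/k⌉ ⟩
  ceilDiv M k ℤ.* + k  <⟨ ceilDiv*k<k+M M k ⟩
  + k ℤ.+ M            ≤⟨ k+M≤ak ⟩
  + (a ℕ.* k)          ≡⟨ ℤP.pos-* a k ⟩
  + a ℤ.* + k          ∎))
  where open ℤP.≤-Reasoning

lemma6 : (k : ℕ) → .{{_ : NonZero k}} → (m : ℕ) → (δ : Vec ℕ m) →
    Valid k m δ →
    (δn : ℕ) → + δn ≤ ceilDiv (sumDefect k m δ) k →
    Valid k (suc m) (δ ∷ʳ δn)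
lemma6 k m δ (A , witness@(_ , uniq , _)) δn δn≤⌈M/k⌉ =
  map dbl A ++ [ y ] , witness-snoc {δ = δ} (witness-map {δ = δ} witness) y∉2A below≡δn
  where
  open OrderEmbedding dbl <⇔dbl<
  k+M≤|actives|*k : + k ℤ.+ sumDefect k m δ ℤ.≤ + (length (actives k A) ℕ.* k)
  k+M≤|actives|*k = subst (ℤ._≤ _) (sizeS≡k+sumDefect {δ = δ} witness) (ℤ.+≤+ (sizeS≤length-actives*k k A))
  rank : ∃ λ c → countLess c (actives k A) ≡ δn
  rank = countLess-surjective (actives-unique k uniq) (ℕP.<⇒≤ (≤ceilDiv⇒< {sumDefect k m δ} δn≤⌈M/k⌉ k+M≤|actives|*k))
  y : ℤ
  y = ℤ.pred (dbl (proj₁ rank))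
  y∉2A : y ∉ map dbl A
  y∉2A y∈2A = let x , _ , y≡2x = ∈-map⁻ dbl y∈2A in dbl≢pred-dbl x (proj₁ rank) (sym y≡2x)
  below≡δn : countLess y (actives k (map dbl A)) ≡ δn
  below≡δn = begin
    countLess y (actives k (map dbl A))  ≡⟨ cong (countLess y) (actives-map k A) ⟩
    countLess y (map dbl (actives k A))  ≡⟨ countLess-map (λ _ → <⇔dbl<pred-dbl) (actives k A) ⟩
    countLess (proj₁ rank) (actives k A) ≡⟨ proj₂ rank ⟩
    δn                                   ∎
    where open ≡-Reasoning
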